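{- Let $A=[a_{ij}]$ be a real $n\times n$ matrix with zero diagonal and $f(\sigma)=\sum_{p=1}^{n-1}\sum_{q=p+1}^{n} a_{\sigma(p)\sigma(q)}$ on $\Sigma_n$. Let $1\le k\le n$, let $i_1,\dots,i_k$ be distinct elements of $\{1,\dots,n\}$, and let $S=\{\sigma\in\Sigma_n:\sigma(1)=i_1,\dots,\sigma(k)=i_k\}$. Then $$\frac{1}{|S|}\sum_{\sigma\in S}f(\sigma)=\sum_{m=1}^{k}\ \sum_{j\in\{1,\dots,n\}\setminus\{i_1,\dots,i_m\}} a_{i_m j}\;+\;\frac12\sum_{l,m\in\{1,\dots,n\}\setminus\{i_1,\dots,i_k\}} a_{lm}.$$
   Context: $\Sigma_n$ is the set of permutations of $\{1,\dots,n\}$; $\sigma(p)$ is the row/column index of $A$ placed in position $p$. -}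

module Defs where

open import Level using (Level)
open import Algebra.Bundles using (CommutativeRing)
open import Data.Nat as ℕ using (ℕ; zero; suc; _≤_)
open import Data.Fin as Fin using (Fin; toℕ; inject≤)
open import Data.Fin.Properties using (all?; _≟_)
open import Data.List using (List; []; _∷_; [_]; map; concatMap; filter; foldr; length)
open import Data.List.Base using () renaming (allFin to allFinL)
open import Data.Vec as Vec using (Vec; lookup)
open import Function.Definitions using (Injective)
open import Relation.Binary.PropositionalEquality using (_≡_)
open import Relation.Nullary using (Dec; ¬_)
open import Relation.Nullary.Decidable using (_→-dec_; ¬?; _×-dec_)
open import Data.Product using (_×_)

allWords : (n m : ℕ) → List (Vec (Fin n) m)
allWords n zero    = [ Vec.[] ]
allWords n (suc m) = concatMap (λ x → map (x Vec.∷_) (allWords n m)) (allFinL n)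

allFuns : (n : ℕ) → List (Fin n → Fin n)
allFuns n = map lookup (allWords n n)

injective? : {n : ℕ} (σ : Fin n → Fin n) → Dec (Injective _≡_ _≡_ σ)
injective? σ = Relation.Nullary.Decidable.map′
  (λ h {x} {y} → h x y) (λ h x y → h {x} {y})
  (all? λ x → all? λ y → (σ x ≟ σ y) →-dec (x ≟ y))
  where import Relation.Nullary.Decidable

-- Σ_n : the list of all permutations of {1,…,n} (each exactly once),
-- a permutation σ being a bijective (equivalently injective) map Fin n → Fin n.
Perms : (n : ℕ) → List (Fin n → Fin n)
Perms n = filter injective? (allFuns n)

fixesPrefix? : {n k : ℕ} (k≤n : k ≤ n) (i : Fin k → Fin n) (σ : Fin n → Fin n) →
               Dec (∀ p → σ (inject≤ p k≤n) ≡ i p)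
fixesPrefix? k≤n i σ = all? λ p → σ (inject≤ p k≤n) ≟ i p

SetS : {n k : ℕ} (k≤n : k ≤ n) (i : Fin k → Fin n) → List (Fin n → Fin n)
SetS k≤n i = filter (fixesPrefix? k≤n i) (Perms _)

module _ {c ℓ : Level} (R : CommutativeRing c ℓ) where
  open CommutativeRing R

  sumL : List Carrier → Carrier
  sumL = foldr _+_ 0#

  fromℕ : ℕ → Carrier
  fromℕ zero    = 0#
  fromℕ (suc m) = 1# + fromℕ m

  fObj : {n : ℕ} (a : Fin n → Fin n → Carrier) (σ : Fin n → Fin n) → Carrier
  fObj {n} a σ = sumL (concatMap (λ p →
                   map (λ q → a (σ p) (σ q)) (filter (λ q → p Fin.<? q) (allFinL n)))
                   (allFinL n))

  -- Σ_{m=1}^{k} Σ_{j ∉ {i_1,…,i_m}} a_{i_m j}   (m is 0-based here)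
  firstTerm : {n k : ℕ} (a : Fin n → Fin n → Carrier) (i : Fin k → Fin n) → Carrier
  firstTerm {n} {k} a i = sumL (concatMap (λ m →
      map (λ j → a (i m) j)
        (filter (λ j → all? λ t → (toℕ t ℕ.≤? toℕ m) →-dec ¬? (j ≟ i t)) (allFinL n)))
      (allFinL k))

  secondTerm : {n k : ℕ} (a : Fin n → Fin n → Carrier) (i : Fin k → Fin n) → Carrier
  secondTerm {n} {k} a i = sumL (concatMap (λ l → map (λ m → a l m) outside) outside)
    where
    outside : List (Fin n)
    outside = filter (λ j → all? λ t → ¬? (j ≟ i t)) (allFinL n)

{-# OPTIONS --safe #-}
-- Sort the pairs p < q of positions of σ ∈ S by p. The pairs with p among the first k positions
-- contribute the first term whatever σ is: σ(p) = i_p, and σ(q) runs over all values other than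
-- i_1, …, i_p. The remaining pairs, k < p < q, form the tail of σ. Reversing the order of the last
-- n − k positions is an involution σ ↦ σ' of S, and the tails of σ and σ' together with the
-- diagonal list every ordered pair of values outside {i_1, …, i_k} exactly once. Since a vanishes
-- on the diagonal, summing over S gives 2 · Σ_σ tail(σ) = |S| · Σ_{l,m} a_{lm}.
-- Sums are compared through their lists of pairs: duplicate-free lists with the same members are
-- permutations of each other.
module Submission where

open import Defs
open import Level using (Level)
open import Algebra.Bundles using (CommutativeRing)
import Algebra.Properties.CommutativeSemigroup as CommSemigroupProperties
open import Data.Nat using (ℕ; zero; suc; _∸_; _≤_; _<_; s≤s; _≤?_)
import Data.Nat.Properties as ℕₚ
open import Data.Fin as Fin using (Fin; toℕ; inject≤; fromℕ<; punchOut)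
open import Data.Fin.Properties
  using ( any?; all?; _≟_; <-cmp; toℕ-injective; toℕ-inject≤; toℕ-fromℕ<; toℕ<n
        ; punchOut-injective; injective⇒≤)
open import Data.List using (List; []; _∷_; map; concatMap; filter; length; _++_)
open import Data.List.Base using () renaming (allFin to allFinL)
open import Data.List.Properties using (map-∘; map-++; map-concatMap; concatMap-cong; length-map)
open import Data.List.Membership.Propositional using (_∈_; find)
open import Data.List.Membership.Propositional.Properties
  using ( ∈-concatMap⁺; ∈-concatMap⁻; ∈-map⁺; ∈-map⁻; ∈-filter⁺; ∈-filter⁻
        ; ∈-++⁺ˡ; ∈-++⁺ʳ; ∈-++⁻; ∈-allFin)
open import Data.List.Membership.Propositional.Properties.WithK using (unique∧set⇒bag)
open import Data.List.Relation.Binary.BagAndSetEquality using (∼bag⇒↭)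
open import Data.List.Relation.Binary.Disjoint.Propositional using (Disjoint)
open import Data.List.Relation.Binary.Permutation.Propositional using (_↭_; ↭⇒↭ₛ′)
import Data.List.Relation.Binary.Permutation.Propositional.Properties as ↭ₚ
open import Data.List.Relation.Binary.Permutation.Setoid.Properties using (foldr-commMonoid)
open import Data.List.Relation.Unary.Unique.Propositional using (Unique)
import Data.List.Relation.Unary.Unique.Propositional.Properties as Uniqueₚ
import Data.List.Relation.Unary.All as All
import Data.List.Relation.Unary.All.Properties as Allₚ
import Data.List.Relation.Unary.AllPairs as AllPairs
import Data.List.Relation.Unary.AllPairs.Properties as AllPairsₚ
open import Data.List.Relation.Unary.Any as Any using (here)
open import Data.Vec as Vec using (Vec; lookup; tabulate)
open import Data.Vec.Properties using (lookup∘tabulate; tabulate∘lookup; tabulate-cong)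
open import Data.Product using (_×_; _,_; proj₁; proj₂; ∃; ∃₂; uncurry)
open import Data.Sum using (inj₁; inj₂)
open import Data.Empty using (⊥-elim)
open import Function using (_∘_)
open import Function.Bundles using (mk⇔)
open import Function.Definitions using (Injective)
open import Relation.Binary.Definitions using (tri<; tri≈; tri>)
open import Relation.Binary.PropositionalEquality
  using (_≡_; _≢_; refl; sym; trans; cong; cong₂; subst; subst₂; module ≡-Reasoning)
open import Relation.Nullary using (yes; no)
open import Relation.Nullary.Decidable using (_→-dec_; ¬?)
open import Relation.Unary using (Pred; Decidable)

private variable
  a ℓ : Level
  A B C X : Set a

↭-fromUnique : {xs ys : List A} → Unique xs → Unique ys →
               (∀ {z} → z ∈ xs → z ∈ ys) → (∀ {z} → z ∈ ys → z ∈ xs) → xs ↭ ys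
↭-fromUnique xs! ys! xs⊆ys ys⊆xs = ∼bag⇒↭ (unique∧set⇒bag xs! ys! (mk⇔ xs⊆ys ys⊆xs))

filter-map : {P : Pred B ℓ} (P? : Decidable P) (f : A → B) (xs : List A) →
             filter P? (map f xs) ≡ map f (filter (P? ∘ f) xs)
filter-map P? f []       = refl
filter-map P? f (x ∷ xs) with P? (f x)
... | yes _ = cong (f x ∷_) (filter-map P? f xs)
... | no  _ = filter-map P? f xs

dependentProductWith : (A → X → B) → List A → (A → List X) → List B
dependentProductWith g xs L = concatMap (λ x → map (g x) (L x)) xs

module _ (g : A → X → B) {xs : List A} {L : A → List X} where

  ∈-dependentProductWith⁺ : ∀ {x y} → x ∈ xs → y ∈ L x → g x y ∈ dependentProductWith g xs L
  ∈-dependentProductWith⁺ x∈xs y∈Lx =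
    ∈-concatMap⁺ _ (Any.map (λ { refl → ∈-map⁺ (g _) y∈Lx }) x∈xs)

  ∈-dependentProductWith⁻ : ∀ {z} → z ∈ dependentProductWith g xs L →
                            ∃₂ λ x y → x ∈ xs × y ∈ L x × z ≡ g x y
  ∈-dependentProductWith⁻ z∈
    with x , x∈xs , z∈map ← find (∈-concatMap⁻ _ z∈)
    with y , y∈Lx , refl ← ∈-map⁻ (g x) z∈map = x , y , x∈xs , y∈Lx , refl

  dependentProductWith⁺ : Unique xs → (∀ x → Unique (L x)) →
                          (∀ {x x′ y y′} → g x y ≡ g x′ y′ → x ≡ x′ × y ≡ y′) →
                          Unique (dependentProductWith g xs L)
  dependentProductWith⁺ xs! L! g-injective = Uniqueₚ.concat⁺
    (Allₚ.map⁺ (All.universal (λ x → Uniqueₚ.map⁺ (λ eq → proj₂ (g-injective eq)) (L! x)) xs))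
    (AllPairsₚ.map⁺ (AllPairs.map disjoint xs!))
    where
    disjoint : ∀ {x x′} → x ≢ x′ → Disjoint (map (g x) (L x)) (map (g x′) (L x′))
    disjoint x≢x′ (z∈ , z∈′) with _ , _ , eq ← ∈-map⁻ _ z∈ | _ , _ , eq′ ← ∈-map⁻ _ z∈′ =
      x≢x′ (proj₁ (g-injective (trans (sym eq) eq′)))

map-dependentProductWith : (f : B → C) (g : A → X → B) (xs : List A) (L : A → List X) →
  map f (dependentProductWith g xs L) ≡ dependentProductWith (λ x y → f (g x y)) xs L
map-dependentProductWith f g xs L =
  trans (map-concatMap f _ xs) (concatMap-cong (λ x → sym (map-∘ (L x))) xs)

module Sums {c ℓ} (R : CommutativeRing c ℓ) where
  open CommutativeRing R renaming (refl to ≈-refl; sym to ≈-sym; trans to ≈-trans)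
  open import Relation.Binary.Reasoning.Setoid setoid

  sum-↭ : {xs ys : List Carrier} → xs ↭ ys → sumL R xs ≈ sumL R ys
  sum-↭ = foldr-commMonoid setoid +-isCommutativeMonoid ∘ ↭⇒↭ₛ′ isEquivalence

  sum-map-↭ : (f : A → Carrier) {xs ys : List A} → xs ↭ ys → sumL R (map f xs) ≈ sumL R (map f ys)
  sum-map-↭ f = sum-↭ ∘ ↭ₚ.map⁺ f

  sum-++ : (xs ys : List Carrier) → sumL R (xs ++ ys) ≈ sumL R xs + sumL R ys
  sum-++ []       ys = ≈-sym (+-identityˡ _)
  sum-++ (x ∷ xs) ys = ≈-trans (+-congˡ (sum-++ xs ys)) (≈-sym (+-assoc _ _ _))

  sum-map-++ : (f : A → Carrier) (xs ys : List A) →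
               sumL R (map f (xs ++ ys)) ≈ sumL R (map f xs) + sumL R (map f ys)
  sum-map-++ f xs ys = ≈-trans (reflexive (cong (sumL R) (map-++ f xs ys))) (sum-++ (map f xs) (map f ys))

  sum-map-+ : (f g : A → Carrier) (xs : List A) →
              sumL R (map (λ x → f x + g x) xs) ≈ sumL R (map f xs) + sumL R (map g xs)
  sum-map-+ f g []       = ≈-sym (+-identityˡ _)
  sum-map-+ f g (x ∷ xs) = begin
    (f x + g x) + sumL R (map (λ x → f x + g x) xs) ≈⟨ +-congˡ (sum-map-+ f g xs) ⟩
    (f x + g x) + (F + G)                             ≈⟨ +-assoc _ _ _ ⟩
    f x + (g x + (F + G))                             ≈⟨ +-congˡ (x∙yz≈y∙xz (g x) F G) ⟩
    f x + (F + (g x + G))                             ≈⟨ +-assoc _ _ _ ⟨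
    (f x + F) + (g x + G)                             ∎
    where
    F G : Carrier
    F = sumL R (map f xs)
    G = sumL R (map g xs)
    open CommSemigroupProperties +-commutativeSemigroup using (x∙yz≈y∙xz)

  sum-map-cong : (f g : A → Carrier) (xs : List A) → (∀ {x} → x ∈ xs → f x ≈ g x) →
                 sumL R (map f xs) ≈ sumL R (map g xs)
  sum-map-cong f g []       f≈g = ≈-refl
  sum-map-cong f g (x ∷ xs) f≈g = +-cong (f≈g (here refl)) (sum-map-cong f g xs (f≈g ∘ Any.there))

  sum-map-const : (z : Carrier) (xs : List A) → sumL R (map (λ _ → z) xs) ≈ fromℕ R (length xs) * z
  sum-map-const z []       = ≈-sym (zeroˡ z)
  sum-map-const z (x ∷ xs) = begin
    z + sumL R (map (λ _ → z) xs)  ≈⟨ +-cong (≈-sym (*-identityˡ z)) (sum-map-const z xs) ⟩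
    1# * z + fromℕ R (length xs) * z ≈⟨ distribʳ z _ _ ⟨
    (1# + fromℕ R (length xs)) * z ∎

  sum-map-zero : (f : A → Carrier) (xs : List A) → (∀ {x} → x ∈ xs → f x ≈ 0#) →
                 sumL R (map f xs) ≈ 0#
  sum-map-zero f xs f≈0 = begin
    sumL R (map f xs)           ≈⟨ sum-map-cong f (λ _ → 0#) xs f≈0 ⟩
    sumL R (map (λ _ → 0#) xs)  ≈⟨ sum-map-const 0# xs ⟩
    fromℕ R (length xs) * 0#    ≈⟨ zeroʳ _ ⟩
    0#                          ∎

module Averaging {c ℓ} (R : CommutativeRing c ℓ) where
  open CommutativeRing R
  open import Relation.Binary.Reasoning.Setoid setoid

  average-from-halves : ∀ {u h N X Y F T} → u * N ≈ 1# → h * (1# + 1#) ≈ 1# →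
                        X ≈ N * F + Y → Y + Y ≈ N * T → u * X ≈ F + h * T
  average-from-halves {u} {h} {N} {X} {Y} {F} {T} uN≈1 2h≈1 X≈ Y+Y≈ = begin
    u * X                 ≈⟨ *-congˡ X≈ ⟩
    u * (N * F + Y)       ≈⟨ distribˡ u _ _ ⟩
    u * (N * F) + u * Y   ≈⟨ +-cong (cancel F) u*Y≈ ⟩
    F + h * T             ∎
    where
    open CommSemigroupProperties *-commutativeSemigroup using (x∙yz≈y∙xz)
    cancel : ∀ z → u * (N * z) ≈ z
    cancel z = begin
      u * (N * z)  ≈⟨ *-assoc u N z ⟨
      (u * N) * z  ≈⟨ *-congʳ uN≈1 ⟩
      1# * z       ≈⟨ *-identityˡ z ⟩
      z            ∎
    Y≈ : Y ≈ h * (N * T)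
    Y≈ = begin
      Y                    ≈⟨ *-identityˡ Y ⟨
      1# * Y               ≈⟨ *-congʳ 2h≈1 ⟨
      h * (1# + 1#) * Y    ≈⟨ *-assoc h _ Y ⟩
      h * ((1# + 1#) * Y)  ≈⟨ *-congˡ (distribʳ Y 1# 1#) ⟩
      h * (1# * Y + 1# * Y) ≈⟨ *-congˡ (+-cong (*-identityˡ Y) (*-identityˡ Y)) ⟩
      h * (Y + Y)          ≈⟨ *-congˡ Y+Y≈ ⟩
      h * (N * T)          ∎
    u*Y≈ : u * Y ≈ h * T
    u*Y≈ = begin
      u * Y            ≈⟨ *-congˡ Y≈ ⟩
      u * (h * (N * T)) ≈⟨ x∙yz≈y∙xz u h _ ⟩
      h * (u * (N * T)) ≈⟨ *-congˡ (cancel T) ⟩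
      h * T            ∎

module _ where
  open import Data.Nat using (_+_)
  open ℕₚ.≤-Reasoning

  m+n∸[1+o]<n : ∀ {m n o} → m ≤ o → o < n → m + n ∸ suc o < n
  m+n∸[1+o]<n {m} {n} {o} m≤o o<n = begin-strict
    m + n ∸ suc o  <⟨ ℕₚ.∸-monoʳ-< (s≤s m≤o) (ℕₚ.≤-trans o<n (ℕₚ.m≤n+m n m)) ⟩
    m + n ∸ m      ≡⟨ ℕₚ.m+n∸m≡n m n ⟩
    n              ∎

  m≤m+n∸[1+o] : ∀ {m n o} → o < n → m ≤ m + n ∸ suc o
  m≤m+n∸[1+o] {m} {n} {o} o<n = begin
    m              ≡⟨ ℕₚ.m+n∸n≡m m n ⟨
    m + n ∸ n      ≤⟨ ℕₚ.∸-monoʳ-≤ (m + n) o<n ⟩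
    m + n ∸ suc o  ∎

  m∸[1+m∸[1+n]]≡n : ∀ {m n} → n < m → m ∸ suc (m ∸ suc n) ≡ n
  m∸[1+m∸[1+n]]≡n {m} {n} n<m =
    trans (cong (m ∸_) (sym (ℕₚ.+-∸-assoc 1 n<m))) (ℕₚ.m∸[m∸n]≡n (ℕₚ.<⇒≤ n<m))

injective⇒surjective : ∀ {n} (σ : Fin n → Fin n) → Injective _≡_ _≡_ σ →
                       ∀ y → ∃ λ x → σ x ≡ y
injective⇒surjective σ σ-injective y with any? (λ x → σ x ≟ y)
... | yes hit = hit
injective⇒surjective {suc n} σ σ-injective y | no miss =
  ⊥-elim (ℕₚ.<-irrefl refl (injective⇒≤ σ-avoiding-y-injective))
  where
  σ≢y : ∀ x → σ x ≢ y
  σ≢y x eq = miss (x , eq)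
  σ-avoiding-y : Fin (suc n) → Fin n
  σ-avoiding-y x = punchOut (σ≢y x ∘ sym)
  σ-avoiding-y-injective : Injective _≡_ _≡_ σ-avoiding-y
  σ-avoiding-y-injective {x} {x′} eq =
    σ-injective (punchOut-injective (σ≢y x ∘ sym) (σ≢y x′ ∘ sym) eq)

allWords-complete : (n m : ℕ) (w : Vec (Fin n) m) → w ∈ allWords n m
allWords-complete n zero    Vec.[]      = here refl
allWords-complete n (suc m) (x Vec.∷ w) =
  ∈-dependentProductWith⁺ Vec._∷_ (∈-allFin x) (allWords-complete n m w)

allWords-unique : (n m : ℕ) → Unique (allWords n m)
allWords-unique n zero    = All.[] AllPairs.∷ AllPairs.[]
allWords-unique n (suc m) = dependentProductWith⁺ Vec._∷_ (Uniqueₚ.allFin⁺ n)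
  (λ _ → allWords-unique n m) (λ { refl → refl , refl })

module Positions {n k : ℕ} (k≤n : k ≤ n) where
  open import Data.Nat using (_+_)

  headPos : Fin k → Fin n
  headPos t = inject≤ t k≤n

  toℕ-headPos : ∀ t → toℕ (headPos t) ≡ toℕ t
  toℕ-headPos t = toℕ-inject≤ t k≤n

  toℕ-headPos<k : ∀ t → toℕ (headPos t) < k
  toℕ-headPos<k t = subst (_< k) (sym (toℕ-headPos t)) (toℕ<n t)

  <k⇒headPos : ∀ p → toℕ p < k → ∃ λ t → headPos t ≡ p
  <k⇒headPos p p<k = fromℕ< p<k , toℕ-injective (trans (toℕ-headPos _) (toℕ-fromℕ< p<k))

  reflect : Fin n → Fin n
  reflect p with k ≤? toℕ p
  ... | yes k≤p = fromℕ< (m+n∸[1+o]<n k≤p (toℕ<n p))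
  ... | no  _   = p

  toℕ-reflect : ∀ p → k ≤ toℕ p → toℕ (reflect p) ≡ k + n ∸ suc (toℕ p)
  toℕ-reflect p k≤p with k ≤? toℕ p
  ... | yes k≤p′ = toℕ-fromℕ< (m+n∸[1+o]<n k≤p′ (toℕ<n p))
  ... | no  k≰p  = ⊥-elim (k≰p k≤p)

  reflect-head : ∀ p → toℕ p < k → reflect p ≡ p
  reflect-head p p<k with k ≤? toℕ p
  ... | yes k≤p = ⊥-elim (ℕₚ.<-irrefl refl (ℕₚ.<-≤-trans p<k k≤p))
  ... | no  _   = refl

  reflect-tail : ∀ p → k ≤ toℕ p → k ≤ toℕ (reflect p)
  reflect-tail p k≤p = subst (k ≤_) (sym (toℕ-reflect p k≤p)) (m≤m+n∸[1+o] (toℕ<n p))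

  reflect-involutive : ∀ p → reflect (reflect p) ≡ p
  reflect-involutive p with ℕₚ.<-≤-connex (toℕ p) k
  ... | inj₁ p<k = trans (cong reflect (reflect-head p p<k)) (reflect-head p p<k)
  ... | inj₂ k≤p = toℕ-injective (begin
    toℕ (reflect (reflect p))          ≡⟨ toℕ-reflect (reflect p) (reflect-tail p k≤p) ⟩
    k + n ∸ suc (toℕ (reflect p))      ≡⟨ cong (λ t → k + n ∸ suc t) (toℕ-reflect p k≤p) ⟩
    k + n ∸ suc (k + n ∸ suc (toℕ p))  ≡⟨ m∸[1+m∸[1+n]]≡n p<k+n ⟩
    toℕ p                              ∎)
    where
    open ≡-Reasoning
    p<k+n : toℕ p < k + n
    p<k+n = ℕₚ.≤-trans (toℕ<n p) (ℕₚ.m≤n+m n k)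

  reflect-injective : Injective _≡_ _≡_ reflect
  reflect-injective {p} {q} eq =
    trans (sym (reflect-involutive p)) (trans (cong reflect eq) (reflect-involutive q))

  reflect-reverses : ∀ {p q} → k ≤ toℕ p → p Fin.< q → reflect q Fin.< reflect p
  reflect-reverses {p} {q} k≤p p<q = subst₂ _<_ (sym (toℕ-reflect q k≤q)) (sym (toℕ-reflect p k≤p))
    (ℕₚ.∸-monoʳ-< (s≤s p<q) (ℕₚ.≤-trans (toℕ<n q) (ℕₚ.m≤n+m n k)))
    where
    k≤q : k ≤ toℕ q
    k≤q = ℕₚ.≤-trans k≤p (ℕₚ.<⇒≤ p<q)

module Placement {n k : ℕ} (k≤n : k ≤ n) (i : Fin k → Fin n) (i-injective : Injective _≡_ _≡_ i) where
  open Positions k≤n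

  Pair : Set
  Pair = Fin n × Fin n

  record IsExtension (σ : Fin n → Fin n) : Set where
    field
      injective : Injective _≡_ _≡_ σ
      prefix    : ∀ t → σ (headPos t) ≡ i t

  Fresh : Fin k → Fin n → Set
  Fresh m j = ∀ t → toℕ t ≤ toℕ m → j ≢ i t

  Outside : Fin n → Set
  Outside j = ∀ t → j ≢ i t

  outside : List (Fin n)
  outside = filter (λ j → all? λ t → ¬? (j ≟ i t)) (allFinL n)

  tailPositions : List (Fin n)
  tailPositions = filter (λ p → k ≤? toℕ p) (allFinL n)

  pairsFrom : (Fin n → Fin n) → List (Fin n) → List Pair
  pairsFrom σ ps = dependentProductWith (λ p q → σ p , σ q) ps (λ p → filter (p Fin.<?_) (allFinL n))

  tailPairs : (Fin n → Fin n) → List Pair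
  tailPairs σ = pairsFrom σ tailPositions

  freshAfter : Fin k → List (Fin n)
  freshAfter m = filter (λ j → all? λ t → (toℕ t ≤? toℕ m) →-dec ¬? (j ≟ i t)) (allFinL n)

  prefixPairs : List Pair
  prefixPairs = dependentProductWith (λ m j → i m , j) (allFinL k) freshAfter

  outsidePairs : List Pair
  outsidePairs = dependentProductWith _,_ outside (λ _ → outside)

  diagonal : List Pair
  diagonal = map (λ x → x , x) outside

  ∈-outside⁺ : ∀ {j} → Outside j → j ∈ outside
  ∈-outside⁺ = ∈-filter⁺ _ (∈-allFin _)

  ∈-outside⁻ : ∀ {j} → j ∈ outside → Outside j
  ∈-outside⁻ j∈ = proj₂ (∈-filter⁻ _ {xs = allFinL n} j∈)

  outside-unique : Unique outside
  outside-unique = Uniqueₚ.filter⁺ _ (Uniqueₚ.allFin⁺ n)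

  ∈-tailPositions⁺ : ∀ {p} → k ≤ toℕ p → p ∈ tailPositions
  ∈-tailPositions⁺ = ∈-filter⁺ _ (∈-allFin _)

  ∈-tailPositions⁻ : ∀ {p} → p ∈ tailPositions → k ≤ toℕ p
  ∈-tailPositions⁻ p∈ = proj₂ (∈-filter⁻ _ {xs = allFinL n} p∈)

  ∈-pairsFrom⁺ : ∀ σ {ps p q} → p ∈ ps → p Fin.< q → (σ p , σ q) ∈ pairsFrom σ ps
  ∈-pairsFrom⁺ σ p∈ p<q =
    ∈-dependentProductWith⁺ (λ p q → σ p , σ q) p∈ (∈-filter⁺ _ (∈-allFin _) p<q)

  ∈-pairsFrom⁻ : ∀ σ ps {z} → z ∈ pairsFrom σ ps →
                 ∃₂ λ p q → p ∈ ps × p Fin.< q × z ≡ (σ p , σ q)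
  ∈-pairsFrom⁻ σ ps z∈
    with p , q , p∈ , q∈ , refl ← ∈-dependentProductWith⁻ (λ p q → σ p , σ q) {ps} z∈ =
    p , q , p∈ , proj₂ (∈-filter⁻ _ {xs = allFinL n} q∈) , refl

  pairsFrom-unique : ∀ {σ ps} → Injective _≡_ _≡_ σ → Unique ps → Unique (pairsFrom σ ps)
  pairsFrom-unique σ-injective ps! = dependentProductWith⁺ _ ps!
    (λ _ → Uniqueₚ.filter⁺ _ (Uniqueₚ.allFin⁺ n))
    (λ eq → σ-injective (cong proj₁ eq) , σ-injective (cong proj₂ eq))

  tailPairs-unique : ∀ {σ} → Injective _≡_ _≡_ σ → Unique (tailPairs σ)
  tailPairs-unique σ-injective = pairsFrom-unique σ-injective (Uniqueₚ.filter⁺ _ (Uniqueₚ.allFin⁺ n))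

  ∈-prefixPairs⁺ : ∀ {m j} → Fresh m j → (i m , j) ∈ prefixPairs
  ∈-prefixPairs⁺ fresh =
    ∈-dependentProductWith⁺ (λ m j → i m , j) (∈-allFin _) (∈-filter⁺ _ (∈-allFin _) fresh)

  ∈-prefixPairs⁻ : ∀ {z} → z ∈ prefixPairs → ∃₂ λ m j → Fresh m j × z ≡ (i m , j)
  ∈-prefixPairs⁻ z∈
    with m , j , _ , j∈ , refl ← ∈-dependentProductWith⁻ (λ m j → i m , j) {allFinL k} {freshAfter} z∈ =
    m , j , proj₂ (∈-filter⁻ _ {xs = allFinL n} j∈) , refl

  prefixPairs-unique : Unique prefixPairs
  prefixPairs-unique = dependentProductWith⁺ _ (Uniqueₚ.allFin⁺ k)
    (λ _ → Uniqueₚ.filter⁺ _ (Uniqueₚ.allFin⁺ n))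
    (λ eq → i-injective (cong proj₁ eq) , cong proj₂ eq)

  ∈-outsidePairs⁺ : ∀ {x y} → x ∈ outside → y ∈ outside → (x , y) ∈ outsidePairs
  ∈-outsidePairs⁺ = ∈-dependentProductWith⁺ _,_

  ∈-outsidePairs⁻ : ∀ {z} → z ∈ outsidePairs →
                    ∃₂ λ x y → x ∈ outside × y ∈ outside × z ≡ (x , y)
  ∈-outsidePairs⁻ = ∈-dependentProductWith⁻ _,_ {outside} {λ _ → outside}

  outsidePairs-unique : Unique outsidePairs
  outsidePairs-unique = dependentProductWith⁺ _,_ outside-unique (λ _ → outside-unique)
    (λ { refl → refl , refl })

  diagonal-unique : Unique diagonal
  diagonal-unique = Uniqueₚ.map⁺ (cong proj₁) outside-unique

  tailPairs-diagonal-disjoint : ∀ {ρ} → Injective _≡_ _≡_ ρ → Disjoint (tailPairs ρ) diagonal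
  tailPairs-diagonal-disjoint {ρ} ρ-injective (z∈ , z∈diag)
    with p , q , _ , p<q , refl ← ∈-pairsFrom⁻ ρ tailPositions z∈
    with _ , _ , eq ← ∈-map⁻ (λ x → x , x) z∈diag
    with refl ← ρ-injective (trans (cong proj₁ eq) (sym (cong proj₂ eq)))
    = ℕₚ.<-irrefl refl p<q

  module Extension {σ : Fin n → Fin n} (σ-extension : IsExtension σ) where
    open IsExtension σ-extension

    surjective : ∀ y → ∃ λ x → σ x ≡ y
    surjective = injective⇒surjective σ injective

    prefix⁻¹ : ∀ {q t} → σ q ≡ i t → q ≡ headPos t
    prefix⁻¹ {q} {t} eq = injective (trans eq (sym (prefix t)))

    tail⇒outside : ∀ {p} → k ≤ toℕ p → σ p ∈ outside
    tail⇒outside {p} k≤p = ∈-outside⁺ λ t eq → ℕₚ.<-irrefl refl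
      (ℕₚ.<-≤-trans (subst (λ q → toℕ q < k) (sym (prefix⁻¹ eq)) (toℕ-headPos<k t)) k≤p)

    outside⇒tail : ∀ p → σ p ∈ outside → k ≤ toℕ p
    outside⇒tail p σp∈ with ℕₚ.<-≤-connex (toℕ p) k
    ... | inj₂ k≤p = k≤p
    ... | inj₁ p<k with t , refl ← <k⇒headPos p p<k = ⊥-elim (∈-outside⁻ σp∈ t (prefix t))

    tailPairs⊆outsidePairs : ∀ {z} → z ∈ tailPairs σ → z ∈ outsidePairs
    tailPairs⊆outsidePairs z∈ with p , q , p∈ , p<q , refl ← ∈-pairsFrom⁻ σ tailPositions z∈ =
      ∈-outsidePairs⁺ (tail⇒outside k≤p) (tail⇒outside (ℕₚ.≤-trans k≤p (ℕₚ.<⇒≤ p<q)))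
      where
      k≤p : k ≤ toℕ p
      k≤p = ∈-tailPositions⁻ p∈

    prefixPairs-tailPairs-disjoint : Disjoint prefixPairs (tailPairs σ)
    prefixPairs-tailPairs-disjoint (z∈ , z∈′)
      with m , j , _ , refl ← ∈-prefixPairs⁻ z∈
      with p , q , p∈ , _ , eq ← ∈-pairsFrom⁻ σ tailPositions z∈′
      = ℕₚ.<-irrefl refl (ℕₚ.<-≤-trans p<k (∈-tailPositions⁻ p∈))
      where
      p<k : toℕ p < k
      p<k = subst (λ q → toℕ q < k) (sym (prefix⁻¹ (sym (cong proj₁ eq)))) (toℕ-headPos<k m)

    pairs⊆prefix++tail : ∀ {z} → z ∈ pairsFrom σ (allFinL n) → z ∈ prefixPairs ++ tailPairs σ
    pairs⊆prefix++tail z∈ with p , q , _ , p<q , refl ← ∈-pairsFrom⁻ σ (allFinL n) z∈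
                          with ℕₚ.<-≤-connex (toℕ p) k
    ... | inj₂ k≤p = ∈-++⁺ʳ prefixPairs (∈-pairsFrom⁺ σ (∈-tailPositions⁺ k≤p) p<q)
    ... | inj₁ p<k with m , refl ← <k⇒headPos p p<k =
      subst (λ x → (x , σ q) ∈ prefixPairs ++ tailPairs σ) (sym (prefix m))
            (∈-++⁺ˡ (∈-prefixPairs⁺ fresh))
      where
      fresh : Fresh m (σ q)
      fresh t t≤m eq with refl ← prefix⁻¹ eq =
        ℕₚ.<-irrefl refl
          (ℕₚ.<-≤-trans p<q (subst₂ _≤_ (sym (toℕ-headPos t)) (sym (toℕ-headPos m)) t≤m))

    prefix++tail⊆pairs : ∀ {z} → z ∈ prefixPairs ++ tailPairs σ → z ∈ pairsFrom σ (allFinL n)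
    prefix++tail⊆pairs z∈ with ∈-++⁻ prefixPairs z∈
    ... | inj₂ z∈tail with p , q , _ , p<q , refl ← ∈-pairsFrom⁻ σ tailPositions z∈tail =
      ∈-pairsFrom⁺ σ (∈-allFin p) p<q
    ... | inj₁ z∈prefix with m , j , fresh , refl ← ∈-prefixPairs⁻ z∈prefix
                        with q , refl ← surjective j
                        with ℕₚ.<-≤-connex (toℕ (headPos m)) (toℕ q)
    ... | inj₁ m<q = subst (λ x → (x , σ q) ∈ pairsFrom σ (allFinL n)) (prefix m)
                       (∈-pairsFrom⁺ σ (∈-allFin (headPos m)) m<q)
    ... | inj₂ q≤m with t , refl ← <k⇒headPos q (ℕₚ.≤-<-trans q≤m (toℕ-headPos<k m)) =
      ⊥-elim (fresh t (subst₂ _≤_ (toℕ-headPos t) (toℕ-headPos m) q≤m) (prefix t))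

    pairs-↭-prefix++tail : pairsFrom σ (allFinL n) ↭ prefixPairs ++ tailPairs σ
    pairs-↭-prefix++tail = ↭-fromUnique
      (pairsFrom-unique injective (Uniqueₚ.allFin⁺ n))
      (Uniqueₚ.++⁺ prefixPairs-unique (tailPairs-unique injective) prefixPairs-tailPairs-disjoint)
      pairs⊆prefix++tail prefix++tail⊆pairs

  ∘reflect-isExtension : ∀ {σ τ} → IsExtension σ → (∀ p → τ p ≡ σ (reflect p)) → IsExtension τ
  ∘reflect-isExtension {σ} {τ} σ-extension τ≗ = record
    { injective = λ {p} {q} eq → reflect-injective (injective (trans (sym (τ≗ p)) (trans eq (τ≗ q))))
    ; prefix    = λ t → trans (τ≗ (headPos t)) (trans (cong σ (reflect-head _ (toℕ-headPos<k t))) (prefix t))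
    }
    where open IsExtension σ-extension

  module Reflection {σ τ : Fin n → Fin n} (σ-extension : IsExtension σ)
                    (τ≗ : ∀ p → τ p ≡ σ (reflect p)) where
    open IsExtension σ-extension
    open Extension σ-extension
    τ-extension : IsExtension τ
    τ-extension = ∘reflect-isExtension σ-extension τ≗
    module τ where
      open IsExtension τ-extension public
      open Extension τ-extension public

    tailPairs-reflect-disjoint : Disjoint (tailPairs σ) (tailPairs τ)
    tailPairs-reflect-disjoint (z∈ , z∈′)
      with p , q , _ , p<q , refl ← ∈-pairsFrom⁻ σ tailPositions z∈
      with p′ , q′ , p′∈ , p′<q′ , eq ← ∈-pairsFrom⁻ τ tailPositions z∈′
      with refl ← injective (trans (cong proj₁ eq) (τ≗ p′))
      with refl ← injective (trans (cong proj₂ eq) (τ≗ q′))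
      = ℕₚ.<-asym p<q (reflect-reverses (∈-tailPositions⁻ p′∈) p′<q′)

    tail++reflect++diagonal⊆outside : ∀ {z} → z ∈ tailPairs σ ++ (tailPairs τ ++ diagonal) →
                                      z ∈ outsidePairs
    tail++reflect++diagonal⊆outside z∈ with ∈-++⁻ (tailPairs σ) z∈
    ... | inj₁ z∈σ = tailPairs⊆outsidePairs z∈σ
    ... | inj₂ z∈′ with ∈-++⁻ (tailPairs τ) z∈′
    ... | inj₁ z∈τ = τ.tailPairs⊆outsidePairs z∈τ
    ... | inj₂ z∈diag with x , x∈ , refl ← ∈-map⁻ (λ x → x , x) z∈diag = ∈-outsidePairs⁺ x∈ x∈

    outside⊆tail++reflect++diagonal : ∀ {z} → z ∈ outsidePairs →
                                      z ∈ tailPairs σ ++ (tailPairs τ ++ diagonal)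
    outside⊆tail++reflect++diagonal z∈
      with x , y , x∈ , y∈ , refl ← ∈-outsidePairs⁻ z∈
      with p , refl ← surjective x
      with q , refl ← surjective y
      with <-cmp p q
    ... | tri< p<q _ _ = ∈-++⁺ˡ (∈-pairsFrom⁺ σ (∈-tailPositions⁺ (outside⇒tail p x∈)) p<q)
    ... | tri≈ _ refl _ = ∈-++⁺ʳ (tailPairs σ) (∈-++⁺ʳ (tailPairs τ) (∈-map⁺ (λ x → x , x) x∈))
    ... | tri> _ _ q<p = ∈-++⁺ʳ (tailPairs σ) (∈-++⁺ˡ (subst₂ (λ x y → (x , y) ∈ tailPairs τ)
          (trans (τ≗ (reflect p)) (cong σ (reflect-involutive p)))
          (trans (τ≗ (reflect q)) (cong σ (reflect-involutive q)))
          (∈-pairsFrom⁺ τ (∈-tailPositions⁺ (reflect-tail p (outside⇒tail p x∈)))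
                          (reflect-reverses (outside⇒tail q y∈) q<p))))

    tail++reflect++diagonal-↭-outside : tailPairs σ ++ (tailPairs τ ++ diagonal) ↭ outsidePairs
    tail++reflect++diagonal-↭-outside = ↭-fromUnique
      (Uniqueₚ.++⁺ (tailPairs-unique injective)
        (Uniqueₚ.++⁺ (tailPairs-unique τ.injective) diagonal-unique
                     (tailPairs-diagonal-disjoint τ.injective))
        disjoint)
      outsidePairs-unique tail++reflect++diagonal⊆outside outside⊆tail++reflect++diagonal
      where
      disjoint : Disjoint (tailPairs σ) (tailPairs τ ++ diagonal)
      disjoint (z∈σ , z∈′) with ∈-++⁻ (tailPairs τ) z∈′
      ... | inj₁ z∈τ    = tailPairs-reflect-disjoint (z∈σ , z∈τ)
      ... | inj₂ z∈diag = tailPairs-diagonal-disjoint injective (z∈σ , z∈diag)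

  Word : Set
  Word = Vec (Fin n) n

  -- S as a list of words: unlike functions, words can be compared, so that reflecting
  -- every member can be shown to permute the list.
  extensionWords : List Word
  extensionWords =
    filter (λ w → fixesPrefix? k≤n i (lookup w)) (filter (λ w → injective? (lookup w)) (allWords n n))

  SetS≡map-lookup : SetS k≤n i ≡ map lookup extensionWords
  SetS≡map-lookup = trans (cong (filter (fixesPrefix? k≤n i)) (filter-map injective? lookup (allWords n n)))
                          (filter-map (fixesPrefix? k≤n i) lookup (filter (injective? ∘ lookup) (allWords n n)))

  ∈-extensionWords⁺ : ∀ {w} → IsExtension (lookup w) → w ∈ extensionWords
  ∈-extensionWords⁺ {w} w-extension =
    ∈-filter⁺ _ (∈-filter⁺ _ (allWords-complete n n w) (λ {x} {y} → injective {x} {y})) prefix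
    where open IsExtension w-extension

  ∈-extensionWords⁻ : ∀ {w} → w ∈ extensionWords → IsExtension (lookup w)
  ∈-extensionWords⁻ w∈ with w∈′ , prefix ← ∈-filter⁻ _ {xs = filter _ (allWords n n)} w∈ =
    record { injective = proj₂ (∈-filter⁻ _ {xs = allWords n n} w∈′) ; prefix = prefix }

  extensionWords-unique : Unique extensionWords
  extensionWords-unique = Uniqueₚ.filter⁺ _ (Uniqueₚ.filter⁺ _ (allWords-unique n n))

  reflectWord : Word → Word
  reflectWord w = tabulate (lookup w ∘ reflect)

  lookup-reflectWord : ∀ w p → lookup (reflectWord w) p ≡ lookup w (reflect p)
  lookup-reflectWord w = lookup∘tabulate (lookup w ∘ reflect)

  reflectWord-involutive : ∀ w → reflectWord (reflectWord w) ≡ w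
  reflectWord-involutive w = trans
    (tabulate-cong (λ p → trans (lookup-reflectWord w (reflect p)) (cong (lookup w) (reflect-involutive p))))
    (tabulate∘lookup w)

  map-reflectWord-↭ : map reflectWord extensionWords ↭ extensionWords
  map-reflectWord-↭ = ↭-fromUnique
    (Uniqueₚ.map⁺ reflectWord-injective extensionWords-unique) extensionWords-unique
    (λ z∈ → let w , w∈ , z≡ = ∈-map⁻ reflectWord z∈ in
            subst (_∈ extensionWords) (sym z≡) (reflect-closed w∈))
    (λ {w} w∈ → subst (_∈ map reflectWord extensionWords) (reflectWord-involutive w)
                      (∈-map⁺ reflectWord (reflect-closed w∈)))
    where
    reflectWord-injective : ∀ {v w} → reflectWord v ≡ reflectWord w → v ≡ w
    reflectWord-injective {v} {w} eq =
      trans (sym (reflectWord-involutive v)) (trans (cong reflectWord eq) (reflectWord-involutive w))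
    reflect-closed : ∀ {w} → w ∈ extensionWords → reflectWord w ∈ extensionWords
    reflect-closed {w} w∈ =
      ∈-extensionWords⁺ (∘reflect-isExtension (∈-extensionWords⁻ w∈) (lookup-reflectWord w))

module Average {c ℓ} (R : CommutativeRing c ℓ) {n k : ℕ} (k≤n : k ≤ n)
               (i : Fin k → Fin n) (i-injective : Injective _≡_ _≡_ i)
               (a : Fin n → Fin n → CommutativeRing.Carrier R)
               (a-diagonal : ∀ j → CommutativeRing._≈_ R (a j j) (CommutativeRing.0# R)) where
  open CommutativeRing R renaming (refl to ≈-refl; sym to ≈-sym; trans to ≈-trans)
  open import Relation.Binary.Reasoning.Setoid setoid
  open Sums R
  open Placement k≤n i i-injective

  pairSum : List Pair → Carrier
  pairSum zs = sumL R (map (uncurry a) zs)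

  fObj≡pairSum : ∀ σ → fObj R a σ ≡ pairSum (pairsFrom σ (allFinL n))
  fObj≡pairSum σ = cong (sumL R) (sym (map-dependentProductWith (uncurry a) _ (allFinL n) _))

  firstTerm≡pairSum : firstTerm R a i ≡ pairSum prefixPairs
  firstTerm≡pairSum = cong (sumL R) (sym (map-dependentProductWith (uncurry a) _ (allFinL k) freshAfter))

  secondTerm≡pairSum : secondTerm R a i ≡ pairSum outsidePairs
  secondTerm≡pairSum = cong (sumL R) (sym (map-dependentProductWith (uncurry a) _,_ outside _))

  diagonal-sum : pairSum diagonal ≈ 0#
  diagonal-sum = ≈-trans (reflexive (cong (sumL R) (sym (map-∘ outside))))
                         (sum-map-zero (λ x → a x x) outside (λ {x} _ → a-diagonal x))

  fObj-extension : ∀ {σ} → IsExtension σ → fObj R a σ ≈ pairSum prefixPairs + pairSum (tailPairs σ)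
  fObj-extension {σ} σ-extension = begin
    fObj R a σ
      ≡⟨ fObj≡pairSum σ ⟩
    pairSum (pairsFrom σ (allFinL n))
      ≈⟨ sum-map-↭ (uncurry a) (Extension.pairs-↭-prefix++tail σ-extension) ⟩
    pairSum (prefixPairs ++ tailPairs σ)
      ≈⟨ sum-map-++ (uncurry a) prefixPairs (tailPairs σ) ⟩
    pairSum prefixPairs + pairSum (tailPairs σ)
      ∎

  tailSum : Word → Carrier
  tailSum w = pairSum (tailPairs (lookup w))

  tailSum-reflect : ∀ {w} → w ∈ extensionWords →
                    tailSum w + tailSum (reflectWord w) ≈ pairSum outsidePairs
  tailSum-reflect {w} w∈ = begin
    pairSum Tσ + pairSum Tτ                      ≈⟨ +-congˡ (+-identityʳ _) ⟨
    pairSum Tσ + (pairSum Tτ + 0#)               ≈⟨ +-congˡ (+-congˡ diagonal-sum) ⟨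
    pairSum Tσ + (pairSum Tτ + pairSum diagonal) ≈⟨ +-congˡ (sum-map-++ (uncurry a) Tτ diagonal) ⟨
    pairSum Tσ + pairSum (Tτ ++ diagonal)        ≈⟨ sum-map-++ (uncurry a) Tσ (Tτ ++ diagonal) ⟨
    pairSum (Tσ ++ (Tτ ++ diagonal))             ≈⟨ sum-map-↭ (uncurry a) covering ⟩
    pairSum outsidePairs                         ∎
    where
    Tσ Tτ : List Pair
    Tσ = tailPairs (lookup w)
    Tτ = tailPairs (lookup (reflectWord w))
    covering : Tσ ++ (Tτ ++ diagonal) ↭ outsidePairs
    covering = Reflection.tail++reflect++diagonal-↭-outside
                 (∈-extensionWords⁻ w∈) (lookup-reflectWord w)

  W : List Word
  W = extensionWords

  N : Carrier
  N = fromℕ R (length W)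

  tailTotal : Carrier
  tailTotal = sumL R (map tailSum W)

  sum-fObj : sumL R (map (fObj R a ∘ lookup) W) ≈ N * pairSum prefixPairs + tailTotal
  sum-fObj = begin
    sumL R (map (fObj R a ∘ lookup) W)
      ≈⟨ sum-map-cong _ _ W (fObj-extension ∘ ∈-extensionWords⁻) ⟩
    sumL R (map (λ w → pairSum prefixPairs + tailSum w) W)
      ≈⟨ sum-map-+ (λ _ → pairSum prefixPairs) tailSum W ⟩
    sumL R (map (λ _ → pairSum prefixPairs) W) + tailTotal
      ≈⟨ +-congʳ (sum-map-const (pairSum prefixPairs) W) ⟩
    N * pairSum prefixPairs + tailTotal
      ∎

  tailTotal-twice : tailTotal + tailTotal ≈ N * pairSum outsidePairs
  tailTotal-twice = begin
    tailTotal + tailTotal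
      ≈⟨ +-congˡ (sum-map-↭ tailSum map-reflectWord-↭) ⟨
    tailTotal + sumL R (map tailSum (map reflectWord W))
      ≡⟨ cong (λ l → tailTotal + sumL R l) (map-∘ W) ⟨
    tailTotal + sumL R (map (tailSum ∘ reflectWord) W)
      ≈⟨ sum-map-+ tailSum (tailSum ∘ reflectWord) W ⟨
    sumL R (map (λ w → tailSum w + tailSum (reflectWord w)) W)
      ≈⟨ sum-map-cong _ _ W tailSum-reflect ⟩
    sumL R (map (λ _ → pairSum outsidePairs) W)
      ≈⟨ sum-map-const (pairSum outsidePairs) W ⟩
    N * pairSum outsidePairs
      ∎

proposition5 : ∀ {c ℓ} (R : CommutativeRing c ℓ) →
    let open CommutativeRing R in
    (n : ℕ) (a : Fin n → Fin n → Carrier) → (∀ i → a i i ≈ 0#) →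
    (k : ℕ) → 1 ≤ k → (k≤n : k ≤ n) →
    (i : Fin k → Fin n) → Injective _≡_ _≡_ i →
    (inv2 : Carrier) → inv2 * (1# + 1#) ≈ 1# →
    (invS : Carrier) → invS * fromℕ R (length (SetS k≤n i)) ≈ 1# →
    invS * sumL R (Data.List.map (fObj R a) (SetS k≤n i))
      ≈ firstTerm R a i + inv2 * secondTerm R a i
proposition5 R n a a-diagonal k _ k≤n i i-injective inv2 inv2-half invS invS-inverse = begin
  invS * sumL R (map (fObj R a) (SetS k≤n i))
    ≡⟨ cong (λ S → invS * sumL R (map (fObj R a) S)) SetS≡map-lookup ⟩
  invS * sumL R (map (fObj R a) (map lookup W))
    ≡⟨ cong (λ l → invS * sumL R l) (map-∘ W) ⟨
  invS * sumL R (map (fObj R a ∘ lookup) W)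
    ≈⟨ average-from-halves invS-inverse′ inv2-half sum-fObj tailTotal-twice ⟩
  pairSum prefixPairs + inv2 * pairSum outsidePairs
    ≡⟨ cong₂ (λ F T → F + inv2 * T) firstTerm≡pairSum secondTerm≡pairSum ⟨
  firstTerm R a i + inv2 * secondTerm R a i
    ∎
  where
  open CommutativeRing R using (_≈_; _+_; _*_; 1#; setoid)
  open import Relation.Binary.Reasoning.Setoid setoid
  open Averaging R using (average-from-halves)
  open Placement k≤n i i-injective using (SetS≡map-lookup; prefixPairs; outsidePairs)
  open Average R k≤n i i-injective a a-diagonal
  invS-inverse′ : invS * N ≈ 1#
  invS-inverse′ = subst (λ m → invS * fromℕ R m ≈ 1#)
    (trans (cong length SetS≡map-lookup) (length-map lookup W)) invS-inverse
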